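{- Define the following signed complete graphs (every edge positive unless listed as negative): $K_3^{(1)}$: $K_3$ with all edges positive; $K_3^{(2)}$: $K_3$ with exactly one negative edge. On vertices $a,b,c,d$: $K_4^{(1)}$: all edges positive; $K_4^{(2)}$: only $cd$ negative; $K_4^{(3)}$: $ab$ and $cd$ negative. On vertices $w_1,\dots,w_5$: $K_5^{(1)}$: all positive; $K_5^{(2)}$: $w_3w_4$ negative; $K_5^{(3)}$: $w_3w_4,w_2w_5$ negative; $K_5^{(4)}$: $w_1w_2,w_1w_5$ negative; $K_5^{(5)}$: $w_1w_2,w_1w_5,w_3w_4$ negative; $K_5^{(6)}$: $w_2w_3,w_3w_4,w_4w_5$ negative; $K_5^{(7)}$: $w_1w_2,w_1w_5,w_3w_4,w_2w_5$ negative. Then for every positive integer $k$, \begin{align*} c_{K_3^{(1)}}(2k+1) &= 8k^3 - 2k , & c_{K_3^{(2)}}(2k+1) &= 8k^3 ,\\ c_{K_4^{(1)}}(2k+1) &= 16k^4-16k^3-4k^2+4k , & c_{K_4^{(2)}}(2k+1) &= 16k^4-16k^3+4k^2 ,\\ c_{K_4^{(3)}}(2k+1) &= 16k^4-16k^3+12k^2-2k , &&\\ c_{K_5^{(1)}}(2k+1) &= 32k^5 - 80k^4 + 40k^3 + 20k^2 - 12k , & c_{K_5^{(2)}}(2k+1) &= 32k^5 - 80k^4 + 64k^3 - 16k^2 ,\\ c_{K_5^{(3)}}(2k+1) &= 32k^5 - 80k^4 + 88k^3 - 48k^2 + 10k , & c_{K_5^{(4)}}(2k+1) &= 32k^5 -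 80k^4 + 72k^3 - 28k^2 + 4k ,\\ c_{K_5^{(5)}}(2k+1) &= 32k^5 - 80k^4 + 96k^3 - 56k^2 + 12k , & c_{K_5^{(6)}}(2k+1) &= 32k^5 - 80k^4 + 80k^3 - 40k^2 + 8k ,\\ c_{K_5^{(7)}}(2k+1) &= 32k^5 - 80k^4 + 120k^3 - 80k^2 + 20k . && \end{align*}
   Context: A signed graph $\Sigma=(V,E,\sigma)$ is a graph with a signature $\sigma\in\{+,-\}^E$ assigning a sign $\sigma_{vw}=\pm1$ to each edge $vw$. For a positive integer $k$, the chromatic polynomial value $c_\Sigma(2k+1)$ is the number of colorings $\mathbf{x}\in\{0,\pm1,\dots,\pm k\}^V$ such that $x_v\neq\sigma_{vw}x_w$ for every edge $vw\in E$. (This count is a polynomial in $k$.) -}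

module Defs where

open import Data.Nat as ℕ using (ℕ; zero; suc)
open import Data.Integer as ℤ using (ℤ; +_; -_; _-_)
open import Data.Fin using (Fin; zero; suc)
open import Data.Vec using (Vec; []; _∷_; lookup)
open import Data.List using (List; []; _∷_; map; concatMap; filter; length; upTo)
open import Data.List.Relation.Unary.All using (All; all?)
open import Data.Product using (_×_; _,_)
open import Relation.Nullary using (¬_; ¬?; Dec)
open import Relation.Binary.PropositionalEquality using (_≡_)

data Sign : Set where
  pos neg : Sign

⟦_⟧ : Sign → ℤ
⟦ pos ⟧ = + 1
⟦ neg ⟧ = - (+ 1)

SignedGraph : ℕ → Set
SignedGraph n = List (Fin n × Fin n × Sign)

-- The colour set {0, ±1, ..., ±k} = {-k, ..., k}
colours : ℕ → List ℤ
colours k = map (λ i → + i - + k) (upTo (suc (2 ℕ.* k)))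

allColourings : (n : ℕ) → List ℤ → List (Vec ℤ n)
allColourings zero    C = [] ∷ []
allColourings (suc n) C = concatMap (λ c → map (c ∷_) (allColourings n C)) C

Proper : ∀ {n} → SignedGraph n → Vec ℤ n → Set
Proper E x = All (λ { (v , w , s) → ¬ (lookup x v ≡ ⟦ s ⟧ ℤ.* lookup x w) }) E

proper? : ∀ {n} (E : SignedGraph n) (x : Vec ℤ n) → Dec (Proper E x)
proper? E x = all? (λ { (v , w , s) → ¬? (lookup x v ℤ.≟ ⟦ s ⟧ ℤ.* lookup x w) }) E

-- c_Σ(2k+1): number of proper colourings with colours in {0, ±1, ..., ±k}
chromatic : ∀ {n} → SignedGraph n → ℕ → ℕ
chromatic {n} E k = length (filter (proper? E) (allColourings n (colours k)))

private
  v0 v1 v2 v3 v4 : ∀ {n} → Fin (suc (suc (suc (suc (suc n)))))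
  v0 = zero
  v1 = suc zero
  v2 = suc (suc zero)
  v3 = suc (suc (suc zero))
  v4 = suc (suc (suc (suc zero)))

K3-1 K3-2 : SignedGraph 3
K3-1 = (zero , suc zero , pos) ∷ (zero , suc (suc zero) , pos) ∷ (suc zero , suc (suc zero) , pos) ∷ []
K3-2 = (zero , suc zero , neg) ∷ (zero , suc (suc zero) , pos) ∷ (suc zero , suc (suc zero) , pos) ∷ []

K4 : (ab ac ad bc bd cd : Sign) → SignedGraph 4
K4 ab ac ad bc bd cd =
  (a , b , ab) ∷ (a , c , ac) ∷ (a , d , ad) ∷ (b , c , bc) ∷ (b , d , bd) ∷ (c , d , cd) ∷ []
  where
  a b c d : Fin 4
  a = zero
  b = suc zero
  c = suc (suc zero)
  d = suc (suc (suc zero))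

K4-1 K4-2 K4-3 : SignedGraph 4
K4-1 = K4 pos pos pos pos pos pos
K4-2 = K4 pos pos pos pos pos neg
K4-3 = K4 neg pos pos pos pos neg

-- K5 on w1..w5 = 0..4 ; signs for w1w2, w1w3, w1w4, w1w5, w2w3, w2w4, w2w5, w3w4, w3w5, w4w5
K5 : (s12 s13 s14 s15 s23 s24 s25 s34 s35 s45 : Sign) → SignedGraph 5
K5 s12 s13 s14 s15 s23 s24 s25 s34 s35 s45 =
  (v0 , v1 , s12) ∷ (v0 , v2 , s13) ∷ (v0 , v3 , s14) ∷ (v0 , v4 , s15) ∷
  (v1 , v2 , s23) ∷ (v1 , v3 , s24) ∷ (v1 , v4 , s25) ∷
  (v2 , v3 , s34) ∷ (v2 , v4 , s35) ∷
  (v3 , v4 , s45) ∷ []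

K5-1 K5-2 K5-3 K5-4 K5-5 K5-6 K5-7 : SignedGraph 5
K5-1 = K5 pos pos pos pos pos pos pos pos pos pos
K5-2 = K5 pos pos pos pos pos pos pos neg pos pos
K5-3 = K5 pos pos pos pos pos pos neg neg pos pos
K5-4 = K5 neg pos pos neg pos pos pos pos pos pos
K5-5 = K5 neg pos pos neg pos pos pos neg pos pos
K5-6 = K5 pos pos pos pos neg pos pos neg pos neg
K5-7 = K5 neg pos pos neg pos pos neg neg pos pos

module Submission where

-- For a set s of active vertices,
-- properCount E s k counts the colourings that give each active vertex a colour
-- in {-k,…,k} and every other vertex the colour 0, and that are proper on the
-- edges inside s; in particular c_E(2k+1) = properCount E ⊤ k.  Passing from
-- level k to level k+1, each active vertex is low (colour -(k+1)), high (colour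
-- k+1) or inner (an old colour).  An edge between a new colour and an old one is
-- never violated, since the colours differ in absolute value, so
--   properCount E s (k+1) = properCount E s k
--                           + Σ_{t strict split of s} [t admissible] · properCount E (innerSet t) k,
-- where a split is admissible when its low/high vertices respect the edges among
-- them.  Consequently properCount E s k = Σ_j (k choose j) · a_{s,j} (Newton's
-- forward-difference formula) with Newton coefficients a_{s,j} defined by a
-- recursion on j, and a_{s,j} = 0 for j > |s| because strict splits have fewer
-- inner vertices.

open import Defs

module Counting where

  open import Algebra.Bundles using (CommutativeMonoid)
  open import Data.Bool using (Bool; true; false; not; _∧_; _∨_; if_then_else_)
  open import Data.Bool.Properties using (∧-commutativeMonoid)
  open import Data.Fin using (zero; suc)
  open import Data.Fin.Subset using (Subset; ⊤) renaming (∣_∣ to size)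
  open import Data.Fin.Subset.Properties using (∣p∣≤n)
  open import Data.Integer as ℤ using (ℤ; +_; -[1+_]; ∣_∣)
  import Data.Integer.Properties as ℤP
  open import Data.List as List using (List; []; _∷_; _++_; map; applyUpTo; concatMap; filter; length; _∷ʳ_)
  import Data.List.Properties as ListP
  open import Data.List.Membership.Propositional using (_∈_)
  open import Data.List.Relation.Unary.All as All using (All; []; _∷_)
  open import Data.List.Relation.Unary.All.Properties using (map⁺; ++⁺)
  open import Data.List.Relation.Unary.Any using (here)
  open import Data.Nat using (ℕ; zero; suc; _+_; _*_; _≤_; _<_; z≤n; s≤s)
  open import Data.Nat.Combinatorics using (nCk+nC[k+1]≡[n+1]C[k+1]) renaming (_C_ to _choose_)
  open import Data.Nat.ListAction using (sum)
  open import Data.Nat.ListAction.Properties using (sum-++)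
  open import Data.Nat.Properties
    using (+-identityʳ; +-comm; *-identityˡ; *-zeroʳ; *-suc; *-distribˡ-+; *-distribʳ-+;
           ≤-refl; ≤-reflexive; m≤n⇒m≤1+n; <-irrefl; <-≤-trans; ≤-<-trans; <⇒≤; ≤-pred;
           +-commutativeSemigroup; *-commutativeSemigroup)
  open import Algebra.Properties.CommutativeSemigroup +-commutativeSemigroup using (interchange; x∙yz≈y∙xz)
  open import Algebra.Properties.CommutativeSemigroup *-commutativeSemigroup
    using () renaming (x∙yz≈y∙xz to x*yz≡y*xz)
  open import Algebra.Properties.CommutativeSemigroup (CommutativeMonoid.commutativeSemigroup ∧-commutativeMonoid)
    using () renaming (interchange to ∧-interchange)
  open import Data.Product using (_×_; _,_)
  open import Data.Unit using (tt) renaming (⊤ to Unit)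
  open import Data.Vec as Vec using (Vec; []; _∷_; lookup)
  import Data.Vec.Properties as VecP
  open import Function using (_∘_; id)
  open import Relation.Binary.PropositionalEquality
  open import Relation.Nullary using (¬_; Dec; does)
  open import Relation.Nullary.Decidable using (dec-true; dec-false)

  sum-map-+ : ∀ {A : Set} (f g : A → ℕ) (xs : List A) →
              sum (map (λ x → f x + g x) xs) ≡ sum (map f xs) + sum (map g xs)
  sum-map-+ f g []       = refl
  sum-map-+ f g (x ∷ xs) =
    trans (cong (λ z → f x + g x + z) (sum-map-+ f g xs)) (interchange (f x) (g x) _ _)

  sum-map-++ : ∀ {A : Set} (f : A → ℕ) (xs ys : List A) →
               sum (map f (xs ++ ys)) ≡ sum (map f xs) + sum (map f ys)
  sum-map-++ f xs ys = trans (cong sum (ListP.map-++ f xs ys)) (sum-++ (map f xs) (map f ys))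

  sum-map-∘ : ∀ {A B : Set} (f : B → ℕ) (g : A → B) (xs : List A) →
              sum (map f (map g xs)) ≡ sum (map (f ∘ g) xs)
  sum-map-∘ f g xs = cong sum (sym (ListP.map-∘ xs))

  sum-cong : ∀ {A : Set} {f g : A → ℕ} (xs : List A) → All (λ x → f x ≡ g x) xs →
             sum (map f xs) ≡ sum (map g xs)
  sum-cong []       []        = refl
  sum-cong (_ ∷ xs) (e ∷ eqs) = cong₂ _+_ e (sum-cong xs eqs)

  sum-zero : ∀ {A : Set} {f : A → ℕ} (xs : List A) → All (λ x → f x ≡ 0) xs → sum (map f xs) ≡ 0
  sum-zero []       []        = refl
  sum-zero (_ ∷ xs) (e ∷ eqs) = cong₂ _+_ e (sum-zero xs eqs)

  *-distrib-sum : ∀ {A : Set} (a : ℕ) (f : A → ℕ) (xs : List A) →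
                  a * sum (map f xs) ≡ sum (map (λ x → a * f x) xs)
  *-distrib-sum a f []       = *-zeroʳ a
  *-distrib-sum a f (x ∷ xs) =
    trans (*-distribˡ-+ a (f x) _) (cong (λ z → a * f x + z) (*-distrib-sum a f xs))

  sum-swap : ∀ {A B : Set} (h : A → B → ℕ) (xs : List A) (ys : List B) →
             sum (map (λ x → sum (map (h x) ys)) xs) ≡ sum (map (λ y → sum (map (λ x → h x y) xs)) ys)
  sum-swap h []       ys = sym (sum-zero ys (All.tabulate (λ _ → refl)))
  sum-swap h (x ∷ xs) ys =
    trans (cong (λ z → sum (map (h x) ys) + z) (sum-swap h xs ys))
          (sym (sum-map-+ (h x) (λ y → sum (map (λ x → h x y) xs)) ys))

  sum-applyUpTo : ∀ (f : ℕ → ℕ) D → sum (applyUpTo f D) ≡ sum (map f (List.upTo D))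
  sum-applyUpTo f D = cong sum (sym (ListP.map-upTo f D))

  sum-applyUpTo-cong : ∀ {f g : ℕ → ℕ} D → (∀ j → f j ≡ g j) →
                       sum (applyUpTo f D) ≡ sum (applyUpTo g D)
  sum-applyUpTo-cong zero    eq = refl
  sum-applyUpTo-cong (suc D) eq = cong₂ _+_ (eq 0) (sum-applyUpTo-cong D (eq ∘ suc))

  sum-applyUpTo-+ : ∀ (f g : ℕ → ℕ) D →
                    sum (applyUpTo (λ j → f j + g j) D) ≡ sum (applyUpTo f D) + sum (applyUpTo g D)
  sum-applyUpTo-+ f g zero    = refl
  sum-applyUpTo-+ f g (suc D) =
    trans (cong (λ z → f 0 + g 0 + z) (sum-applyUpTo-+ (f ∘ suc) (g ∘ suc) D))
          (interchange (f 0) (g 0) _ _)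

  sum-applyUpTo-last : ∀ (f : ℕ → ℕ) D → sum (applyUpTo f (suc D)) ≡ sum (applyUpTo f D) + f D
  sum-applyUpTo-last f D = begin
      sum (applyUpTo f (suc D))        ≡⟨ cong sum (ListP.applyUpTo-∷ʳ f D) ⟨
      sum (applyUpTo f D ∷ʳ f D)       ≡⟨ sum-++ (applyUpTo f D) (f D ∷ []) ⟩
      sum (applyUpTo f D) + (f D + 0)  ≡⟨ cong (λ z → sum (applyUpTo f D) + z) (+-identityʳ (f D)) ⟩
      sum (applyUpTo f D) + f D        ∎
    where open ≡-Reasoning

  colours-suc : ∀ k → colours (suc k) ≡ -[1+ k ] ∷ (colours k ++ (+ suc k ∷ []))
  colours-suc k = begin
      colours (suc k)
    ≡⟨ ListP.map-applyUpTo id (shifted (suc k)) (suc (2 * suc k)) ⟩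
      applyUpTo (shifted (suc k)) (suc (2 * suc k))
    ≡⟨ cong (λ m → applyUpTo (shifted (suc k)) (suc m)) (*-suc 2 k) ⟩
      shifted (suc k) 0 ∷ applyUpTo (shifted (suc k) ∘ suc) (suc (suc (2 * k)))
    ≡⟨ cong (-[1+ k ] ∷_) (ListP.applyUpTo-∷ʳ (shifted (suc k) ∘ suc) (suc (2 * k))) ⟨
      -[1+ k ] ∷ (applyUpTo (shifted (suc k) ∘ suc) (suc (2 * k)) ∷ʳ shifted (suc k) (suc (suc (2 * k))))
    ≡⟨ cong₂ (λ cs c → -[1+ k ] ∷ (cs ∷ʳ c)) (applyUpTo-cong (suc (2 * k)) shift-down) top-colour ⟩
      -[1+ k ] ∷ (applyUpTo (shifted k) (suc (2 * k)) ∷ʳ + suc k)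
    ≡⟨ cong (λ cs → -[1+ k ] ∷ (cs ∷ʳ + suc k)) (ListP.map-applyUpTo id (shifted k) (suc (2 * k))) ⟨
      -[1+ k ] ∷ (colours k ++ (+ suc k ∷ [])) ∎
    where
    open ≡-Reasoning
    open import Data.Integer.Tactic.RingSolver using (solve-∀)
    shifted : ℕ → ℕ → ℤ
    shifted k i = + i ℤ.- + k
    applyUpTo-cong : ∀ {f g : ℕ → ℤ} m → (∀ i → f i ≡ g i) → applyUpTo f m ≡ applyUpTo g m
    applyUpTo-cong zero    eq = refl
    applyUpTo-cong (suc m) eq = cong₂ _∷_ (eq 0) (applyUpTo-cong m (eq ∘ suc))
    shift-down : ∀ i → shifted (suc k) (suc i) ≡ shifted k i
    shift-down i = begin
      + suc i ℤ.- + suc k  ≡⟨ ℤP.m-n≡m⊖n (suc i) (suc k) ⟩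
      suc i ℤ.⊖ suc k      ≡⟨ ℤP.[1+m]⊖[1+n]≡m⊖n i k ⟩
      i ℤ.⊖ k              ≡⟨ ℤP.m-n≡m⊖n i k ⟨
      + i ℤ.- + k          ∎
    cancel : ∀ K → (+ 2 ℤ.+ + 2 ℤ.* K) ℤ.- (+ 1 ℤ.+ K) ≡ + 1 ℤ.+ K
    cancel = solve-∀
    top-colour : shifted (suc k) (suc (suc (2 * k))) ≡ + suc k
    top-colour = begin
        + (2 + 2 * k) ℤ.- + (1 + k)
      ≡⟨ cong₂ ℤ._-_ (ℤP.pos-+ 2 (2 * k)) (ℤP.pos-+ 1 k) ⟩
        (+ 2 ℤ.+ + (2 * k)) ℤ.- (+ 1 ℤ.+ + k)
      ≡⟨ cong (λ a → (+ 2 ℤ.+ a) ℤ.- (+ 1 ℤ.+ + k)) (ℤP.pos-* 2 k) ⟩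
        (+ 2 ℤ.+ + 2 ℤ.* + k) ℤ.- (+ 1 ℤ.+ + k)
      ≡⟨ cancel (+ k) ⟩
        + 1 ℤ.+ + k
      ≡⟨ ℤP.pos-+ 1 k ⟨
        + suc k ∎

  colours-bounded : ∀ k → All (λ c → ∣ c ∣ ≤ k) (colours k)
  colours-bounded zero    = z≤n ∷ []
  colours-bounded (suc k) rewrite colours-suc k =
    ≤-refl ∷ ++⁺ (All.map m≤n⇒m≤1+n (colours-bounded k)) (≤-refl ∷ [])

  sumOver : ∀ {n} → Vec (List ℤ) n → (Vec ℤ n → ℕ) → ℕ
  sumOver []      f = f []
  sumOver (C ∷ D) f = sum (map (λ c → sumOver D (λ x → f (c ∷ x))) C)

  _∈ᵛ_ : ∀ {n} → Vec ℤ n → Vec (List ℤ) n → Set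
  []      ∈ᵛ []      = Unit
  (c ∷ x) ∈ᵛ (C ∷ D) = c ∈ C × x ∈ᵛ D

  ∈ᵛ-lookup : ∀ {n} {x : Vec ℤ n} {D : Vec (List ℤ) n} → x ∈ᵛ D → ∀ v → lookup x v ∈ lookup D v
  ∈ᵛ-lookup {x = _ ∷ _} {_ ∷ _} (c∈C , _)  zero    = c∈C
  ∈ᵛ-lookup {x = _ ∷ _} {_ ∷ _} (_ , x∈D)  (suc v) = ∈ᵛ-lookup x∈D v

  sumOver-cong : ∀ {n} (D : Vec (List ℤ) n) {f g : Vec ℤ n → ℕ} → (∀ x → x ∈ᵛ D → f x ≡ g x) →
                 sumOver D f ≡ sumOver D g
  sumOver-cong []      eq = eq [] tt
  sumOver-cong (C ∷ D) eq =
    sum-cong C (All.tabulate λ c∈C → sumOver-cong D (λ x x∈D → eq _ (c∈C , x∈D)))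

  sumOver-scale : ∀ {n} (D : Vec (List ℤ) n) (a : ℕ) (f : Vec ℤ n → ℕ) →
                  sumOver D (λ x → a * f x) ≡ a * sumOver D f
  sumOver-scale []      a f = refl
  sumOver-scale (C ∷ D) a f =
    trans (sum-cong C (All.tabulate λ {c} _ → sumOver-scale D a (λ x → f (c ∷ x))))
          (sym (*-distrib-sum a _ C))

  sumOver-allColourings : ∀ n (C : List ℤ) (f : Vec ℤ n → ℕ) →
                          sum (map f (allColourings n C)) ≡ sumOver (Vec.replicate n C) f
  sumOver-allColourings zero    C f = +-identityʳ (f [])
  sumOver-allColourings (suc n) C f = go C
    where
    go : ∀ C′ → sum (map f (concatMap (λ c → map (c ∷_) (allColourings n C)) C′))
              ≡ sum (map (λ c → sumOver (Vec.replicate n C) (λ x → f (c ∷ x))) C′)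
    go []       = refl
    go (c ∷ C′) = begin
        sum (map f (map (c ∷_) (allColourings n C) ++ concatMap _ C′))
      ≡⟨ sum-map-++ f (map (c ∷_) (allColourings n C)) _ ⟩
        sum (map f (map (c ∷_) (allColourings n C))) + sum (map f (concatMap _ C′))
      ≡⟨ cong₂ _+_ (trans (sum-map-∘ f (c ∷_) (allColourings n C)) (sumOver-allColourings n C _)) (go C′) ⟩
        sumOver (Vec.replicate n C) (λ x → f (c ∷ x)) + sum (map _ C′) ∎
      where open ≡-Reasoning

  activeColours : Bool → ℕ → List ℤ
  activeColours true  k = colours k
  activeColours false k = + 0 ∷ []

  palette : ∀ {n} → Subset n → ℕ → Vec (List ℤ) n
  palette s k = Vec.map (λ b → activeColours b k) s

  data Part : Set where
    low inner high off : Part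

  partColours : Part → ℕ → List ℤ
  partColours low   k = -[1+ k ] ∷ []
  partColours inner k = colours k
  partColours high  k = + suc k ∷ []
  partColours off   k = + 0 ∷ []

  splitPalette : ∀ {n} → Vec Part n → ℕ → Vec (List ℤ) n
  splitPalette t k = Vec.map (λ p → partColours p k) t

  isActive isInner : Part → Bool
  isActive off   = false
  isActive _     = true
  isInner  inner = true
  isInner  _     = false

  active innerSet : ∀ {n} → Vec Part n → Subset n
  active   t = Vec.map isActive t
  innerSet t = Vec.map isInner t

  unsplit : ∀ {n} → Subset n → Vec Part n
  unsplit s = Vec.map (λ b → if b then inner else off) s

  splits strictSplits : ∀ {n} → Subset n → List (Vec Part n)
  splits s = unsplit s ∷ strictSplits s
  strictSplits []          = []
  strictSplits (true  ∷ s) =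
    map (inner ∷_) (strictSplits s) ++ (map (low ∷_) (splits s) ++ map (high ∷_) (splits s))
  strictSplits (false ∷ s) = map (off ∷_) (strictSplits s)

  unsplit-active : ∀ {n} (s : Subset n) → active (unsplit s) ≡ s
  unsplit-active []          = refl
  unsplit-active (true  ∷ s) = cong (true ∷_) (unsplit-active s)
  unsplit-active (false ∷ s) = cong (false ∷_) (unsplit-active s)

  unsplit-inner : ∀ {n} (s : Subset n) → innerSet (unsplit s) ≡ s
  unsplit-inner []          = refl
  unsplit-inner (true  ∷ s) = cong (true ∷_) (unsplit-inner s)
  unsplit-inner (false ∷ s) = cong (false ∷_) (unsplit-inner s)

  splits-active : ∀ {n} (s : Subset n) → All (λ t → active t ≡ s) (splits s)
  strictSplits-active : ∀ {n} (s : Subset n) → All (λ t → active t ≡ s) (strictSplits s)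
  splits-active s = unsplit-active s ∷ strictSplits-active s
  strictSplits-active []          = []
  strictSplits-active (true  ∷ s) =
    ++⁺ (map⁺ (All.map (cong (true ∷_)) (strictSplits-active s)))
        (++⁺ (map⁺ (All.map (cong (true ∷_)) (splits-active s)))
             (map⁺ (All.map (cong (true ∷_)) (splits-active s))))
  strictSplits-active (false ∷ s) = map⁺ (All.map (cong (false ∷_)) (strictSplits-active s))

  splits-inner-≤ : ∀ {n} (s : Subset n) → All (λ t → size (innerSet t) ≤ size s) (splits s)
  strictSplits-inner-< : ∀ {n} (s : Subset n) → All (λ t → size (innerSet t) < size s) (strictSplits s)
  splits-inner-≤ s = ≤-reflexive (cong size (unsplit-inner s)) ∷ All.map <⇒≤ (strictSplits-inner-< s)
  strictSplits-inner-< []          = []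
  strictSplits-inner-< (true  ∷ s) =
    ++⁺ (map⁺ (All.map s≤s (strictSplits-inner-< s)))
        (++⁺ (map⁺ (All.map s≤s (splits-inner-≤ s))) (map⁺ (All.map s≤s (splits-inner-≤ s))))
  strictSplits-inner-< (false ∷ s) = map⁺ (strictSplits-inner-< s)

  sumOver-levels : ∀ {n} k (D : Vec (List ℤ) n) (f : Vec ℤ (suc n) → ℕ) →
    sumOver (colours (suc k) ∷ D) f
      ≡ sumOver (partColours low k ∷ D) f + (sumOver (colours k ∷ D) f + sumOver (partColours high k ∷ D) f)
  sumOver-levels k D f = begin
      sum (map g (colours (suc k)))
    ≡⟨ cong (λ cs → sum (map g cs)) (colours-suc k) ⟩
      g -[1+ k ] + sum (map g (colours k ++ (+ suc k ∷ [])))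
    ≡⟨ cong (λ z → g -[1+ k ] + z) (sum-map-++ g (colours k) (+ suc k ∷ [])) ⟩
      g -[1+ k ] + (sum (map g (colours k)) + (g (+ suc k) + 0))
    ≡⟨ cong (λ z → z + (sum (map g (colours k)) + (g (+ suc k) + 0))) (+-identityʳ (g -[1+ k ])) ⟨
      (g -[1+ k ] + 0) + (sum (map g (colours k)) + (g (+ suc k) + 0)) ∎
    where
    open ≡-Reasoning
    g : ℤ → ℕ
    g c = sumOver D (λ x → f (c ∷ x))

  sumOver-split : ∀ {n} (s : Subset n) k (f : Vec ℤ n → ℕ) →
    sumOver (palette s (suc k)) f ≡ sum (map (λ t → sumOver (splitPalette t k) f) (splits s))
  sumOver-head-split : ∀ {n} (s : Subset n) k (f : Vec ℤ (suc n) → ℕ) (C : List ℤ) →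
    sumOver (C ∷ palette s (suc k)) f ≡ sum (map (λ t → sumOver (C ∷ splitPalette t k) f) (splits s))

  sumOver-split []          k f = sym (+-identityʳ (f []))
  sumOver-split (false ∷ s) k f =
    trans (sumOver-head-split s k f (+ 0 ∷ [])) (sym (sum-map-∘ _ (off ∷_) (splits s)))
  sumOver-split {suc n} (true ∷ s) k f = begin
      sumOver (colours (suc k) ∷ P) f
    ≡⟨ sumOver-levels k P f ⟩
      sumOver (partColours low k ∷ P) f + (sumOver (colours k ∷ P) f + sumOver (partColours high k ∷ P) f)
    ≡⟨ x∙yz≈y∙xz (sumOver (partColours low k ∷ P) f) (sumOver (colours k ∷ P) f) _ ⟩
      sumOver (colours k ∷ P) f + (sumOver (partColours low k ∷ P) f + sumOver (partColours high k ∷ P) f)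
    ≡⟨ cong₂ _+_ (along inner) (cong₂ _+_ (along low) (along high)) ⟩
      sum (map h (map (inner ∷_) r)) + (sum (map h (map (low ∷_) r)) + sum (map h (map (high ∷_) r)))
    ≡⟨ cong (λ z → sum (map h (map (inner ∷_) r)) + z) (sum-map-++ h (map (low ∷_) r) _) ⟨
      sum (map h (map (inner ∷_) r)) + sum (map h (map (low ∷_) r ++ map (high ∷_) r))
    ≡⟨ sum-map-++ h (map (inner ∷_) r) _ ⟨
      sum (map h (splits (true ∷ s))) ∎
    where
    open ≡-Reasoning
    P : Vec (List ℤ) n
    P = palette s (suc k)
    r : List (Vec Part n)
    r = splits s
    h : Vec Part (suc n) → ℕ
    h t = sumOver (splitPalette t k) f
    along : ∀ p → sumOver (partColours p k ∷ P) f ≡ sum (map h (map (p ∷_) r))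
    along p = trans (sumOver-head-split s k f (partColours p k)) (sym (sum-map-∘ h (p ∷_) r))

  sumOver-head-split s k f C =
    trans (sum-cong C (All.tabulate λ {c} _ → sumOver-split s k (λ x → f (c ∷ x))))
          (sum-swap (λ c t → sumOver (splitPalette t k) (λ x → f (c ∷ x))) C (splits s))

  Agree : ∀ {n} → Subset n → Vec ℤ n → Vec ℤ n → Set
  Agree []          []      []      = Unit
  Agree (true  ∷ m) (a ∷ x) (b ∷ y) = a ≡ b × Agree m x y
  Agree (false ∷ m) (_ ∷ x) (_ ∷ y) = Agree m x y

  agree-lookup : ∀ {n} (m : Subset n) {x y : Vec ℤ n} → Agree m x y →
                 ∀ v → lookup m v ≡ true → lookup x v ≡ lookup y v
  agree-lookup (true  ∷ m) {_ ∷ _} {_ ∷ _} (a≡b , _)  zero    _  = a≡b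
  agree-lookup (true  ∷ m) {_ ∷ _} {_ ∷ _} (_ , agree) (suc v) mv = agree-lookup m agree v mv
  agree-lookup (false ∷ m) {_ ∷ _} {_ ∷ _} agree      (suc v) mv = agree-lookup m agree v mv

  -- Outside its inner vertices a split carries one fixed colour per vertex, so
  -- a summand that only looks at the inner vertices has the same sum over the
  -- colourings of type t as over the colourings of level k of innerSet t.
  sumOver-inner : ∀ {n} k (t : Vec Part n) (f g : Vec ℤ n → ℕ) →
    (∀ x y → Agree (innerSet t) x y → f x ≡ g y) →
    sumOver (splitPalette t k) f ≡ sumOver (palette (innerSet t) k) g
  sumOver-inner k []          f g eq = eq [] [] tt
  sumOver-inner k (inner ∷ t) f g eq =
    sum-cong (colours k) (All.tabulate λ {c} _ →
      sumOver-inner k t _ _ λ x y agree → eq (c ∷ x) (c ∷ y) (refl , agree))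
  sumOver-inner k (low   ∷ t) f g eq =
    cong (λ z → z + 0) (sumOver-inner k t _ _ λ x y → eq (-[1+ k ] ∷ x) (+ 0 ∷ y))
  sumOver-inner k (high  ∷ t) f g eq =
    cong (λ z → z + 0) (sumOver-inner k t _ _ λ x y → eq (+ suc k ∷ x) (+ 0 ∷ y))
  sumOver-inner k (off   ∷ t) f g eq =
    cong (λ z → z + 0) (sumOver-inner k t _ _ λ x y → eq (+ 0 ∷ x) (+ 0 ∷ y))

  edgeOk : Sign → ℤ → ℤ → Bool
  edgeOk σ a b = not (does (a ℤ.≟ ⟦ σ ⟧ ℤ.* b))

  properOn : ∀ {n} → Subset n → SignedGraph n → Vec ℤ n → Bool
  properOn s []                x = true
  properOn s ((v , w , σ) ∷ E) x =
    (not (lookup s v ∧ lookup s w) ∨ edgeOk σ (lookup x v) (lookup x w)) ∧ properOn s E x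

  properOn-agree : ∀ {n} (m : Subset n) (E : SignedGraph n) {x y : Vec ℤ n} → Agree m x y →
                   properOn m E x ≡ properOn m E y
  properOn-agree m []                agree = refl
  properOn-agree m ((v , w , σ) ∷ E) agree with lookup m v in mv | lookup m w in mw
  ... | false | _     = properOn-agree m E agree
  ... | true  | false = properOn-agree m E agree
  ... | true  | true  = cong₂ _∧_ (cong₂ (edgeOk σ) (agree-lookup m agree v mv) (agree-lookup m agree w mw))
                                  (properOn-agree m E agree)

  bit : Bool → ℕ
  bit true  = 1
  bit false = 0

  bit-∧ : ∀ a b → bit (a ∧ b) ≡ bit a * bit b
  bit-∧ true  b = sym (*-identityˡ (bit b))
  bit-∧ false b = refl

  properCount : ∀ {n} → SignedGraph n → Subset n → ℕ → ℕ
  properCount E s k = sumOver (palette s k) (λ x → bit (properOn s E x))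

  chromatic≡properCount : ∀ {n} (E : SignedGraph n) k → chromatic E k ≡ properCount E ⊤ k
  chromatic≡properCount {n} E k = begin
      length (filter (proper? E) (allColourings n (colours k)))
    ≡⟨ length-filter (proper? E) (allColourings n (colours k)) ⟩
      sum (map (λ x → bit (does (proper? E x))) (allColourings n (colours k)))
    ≡⟨ sumOver-allColourings n (colours k) (λ x → bit (does (proper? E x))) ⟩
      sumOver (Vec.replicate n (colours k)) (λ x → bit (does (proper? E x)))
    ≡⟨ sumOver-cong (Vec.replicate n (colours k)) (λ x _ → cong bit (proper?≡properOn E x)) ⟩
      sumOver (Vec.replicate n (colours k)) (λ x → bit (properOn ⊤ E x))
    ≡⟨ cong (λ D → sumOver D (λ x → bit (properOn ⊤ E x)))
            (VecP.map-replicate (λ b → activeColours b k) true n) ⟨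
      properCount E ⊤ k ∎
    where
    open ≡-Reasoning
    length-filter : ∀ {X : Set} {P : X → Set} (P? : ∀ x → Dec (P x)) (xs : List X) →
                    length (filter P? xs) ≡ sum (map (λ x → bit (does (P? x))) xs)
    length-filter P? []       = refl
    length-filter P? (x ∷ xs) with does (P? x)
    ... | true  = cong suc (length-filter P? xs)
    ... | false = length-filter P? xs
    proper?≡properOn : ∀ {n} (E : SignedGraph n) x → does (proper? E x) ≡ properOn ⊤ E x
    proper?≡properOn []                x = refl
    proper?≡properOn ((v , w , σ) ∷ E) x
      rewrite VecP.lookup-replicate v true | VecP.lookup-replicate w true =
      cong (edgeOk σ (lookup x v) (lookup x w) ∧_) (proper?≡properOn E x)

  -- Two vertices with the new colours ±(k+1) conflict across an edge of sign σ
  -- exactly when x_v = σ x_w; every other combination of parts is compatible.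
  compatible : Part → Part → Sign → Bool
  compatible low  low  pos = false
  compatible high high pos = false
  compatible low  high neg = false
  compatible high low  neg = false
  compatible _    _    _   = true

  admissible : ∀ {n} → SignedGraph n → Vec Part n → Bool
  admissible []                t = true
  admissible ((v , w , σ) ∷ E) t = compatible (lookup t v) (lookup t w) σ ∧ admissible E t

  admissible-unsplit : ∀ {n} (E : SignedGraph n) (s : Subset n) → admissible E (unsplit s) ≡ true
  admissible-unsplit []                s = refl
  admissible-unsplit ((v , w , σ) ∷ E) s
    rewrite VecP.lookup-map v (λ b → if b then inner else off) s
          | VecP.lookup-map w (λ b → if b then inner else off) s =
    cong₂ _∧_ (unsplit-compatible (lookup s v) (lookup s w)) (admissible-unsplit E s)
    where
    unsplit-compatible : ∀ a b → compatible (if a then inner else off) (if b then inner else off) σ ≡ true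
    unsplit-compatible true  true  = refl
    unsplit-compatible true  false = refl
    unsplit-compatible false _     = refl

  edgeOk-conflict : ∀ σ a b → a ≡ ⟦ σ ⟧ ℤ.* b → edgeOk σ a b ≡ false
  edgeOk-conflict σ a b eq = cong not (dec-true (a ℤ.≟ ⟦ σ ⟧ ℤ.* b) eq)

  edgeOk-distinct : ∀ σ a b → ¬ (a ≡ ⟦ σ ⟧ ℤ.* b) → edgeOk σ a b ≡ true
  edgeOk-distinct σ a b neq = cong not (dec-false (a ℤ.≟ ⟦ σ ⟧ ℤ.* b) neq)

  edgeOk-abs : ∀ σ a b → ¬ (∣ a ∣ ≡ ∣ b ∣) → edgeOk σ a b ≡ true
  edgeOk-abs σ a b neq =
    edgeOk-distinct σ a b λ eq → neq (trans (cong ∣_∣ eq) (trans (ℤP.abs-* ⟦ σ ⟧ b) (sign-abs σ)))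
    where
    sign-abs : ∀ σ → ∣ ⟦ σ ⟧ ∣ * ∣ b ∣ ≡ ∣ b ∣
    sign-abs pos = *-identityˡ ∣ b ∣
    sign-abs neg = *-identityˡ ∣ b ∣

  inner-abs : ∀ k {c} → c ∈ colours k → ∣ c ∣ < suc k
  inner-abs k c∈ = s≤s (All.lookup (colours-bounded k) c∈)

  edge-split : ∀ k p q σ {a b} → a ∈ partColours p k → b ∈ partColours q k →
    (not (isActive p ∧ isActive q) ∨ edgeOk σ a b)
      ≡ compatible p q σ ∧ (not (isInner p ∧ isInner q) ∨ edgeOk σ a b)
  edge-split k low   low   pos (here refl) (here refl) =
    edgeOk-conflict pos -[1+ k ] -[1+ k ] (sym (ℤP.*-identityˡ -[1+ k ]))
  edge-split k low   low   neg (here refl) (here refl) = edgeOk-distinct neg -[1+ k ] -[1+ k ] λ ()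
  edge-split k high  high  pos (here refl) (here refl) =
    edgeOk-conflict pos (+ suc k) (+ suc k) (sym (ℤP.*-identityˡ (+ suc k)))
  edge-split k high  high  neg (here refl) (here refl) = edgeOk-distinct neg (+ suc k) (+ suc k) λ ()
  edge-split k low   high  pos (here refl) (here refl) = edgeOk-distinct pos -[1+ k ] (+ suc k) λ ()
  edge-split k low   high  neg (here refl) (here refl) =
    edgeOk-conflict neg -[1+ k ] (+ suc k) (sym (ℤP.-1*i≡-i (+ suc k)))
  edge-split k high  low   pos (here refl) (here refl) = edgeOk-distinct pos (+ suc k) -[1+ k ] λ ()
  edge-split k high  low   neg (here refl) (here refl) =
    edgeOk-conflict neg (+ suc k) -[1+ k ] (sym (ℤP.-1*i≡-i -[1+ k ]))
  edge-split k low   inner σ {b = b} (here refl) b∈ =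
    edgeOk-abs σ -[1+ k ] b λ eq → <-irrefl (sym eq) (inner-abs k b∈)
  edge-split k high  inner σ {b = b} (here refl) b∈ =
    edgeOk-abs σ (+ suc k) b λ eq → <-irrefl (sym eq) (inner-abs k b∈)
  edge-split k inner low   σ {a} a∈ (here refl) = edgeOk-abs σ a -[1+ k ] λ eq → <-irrefl eq (inner-abs k a∈)
  edge-split k inner high  σ {a} a∈ (here refl) = edgeOk-abs σ a (+ suc k) λ eq → <-irrefl eq (inner-abs k a∈)
  edge-split k inner inner σ _ _ = refl
  edge-split k off   _     σ _ _ = refl
  edge-split k low   off   σ _ _ = refl
  edge-split k inner off   σ _ _ = refl
  edge-split k high  off   σ _ _ = refl

  properOn-split : ∀ {n} k (E : SignedGraph n) (t : Vec Part n) {x : Vec ℤ n} → x ∈ᵛ splitPalette t k →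
    properOn (active t) E x ≡ admissible E t ∧ properOn (innerSet t) E x
  properOn-split k []                t x∈ = refl
  properOn-split k ((v , w , σ) ∷ E) t {x} x∈ =
    trans (cong₂ _∧_ edge (properOn-split k E t x∈))
          (∧-interchange (compatible (lookup t v) (lookup t w) σ) _ (admissible E t) (properOn (innerSet t) E x))
    where
    colourAt : ∀ u → lookup x u ∈ partColours (lookup t u) k
    colourAt u = subst (lookup x u ∈_) (VecP.lookup-map u (λ p → partColours p k) t) (∈ᵛ-lookup x∈ u)
    edge : (not (lookup (active t) v ∧ lookup (active t) w) ∨ edgeOk σ (lookup x v) (lookup x w))
           ≡ compatible (lookup t v) (lookup t w) σ
             ∧ (not (lookup (innerSet t) v ∧ lookup (innerSet t) w) ∨ edgeOk σ (lookup x v) (lookup x w))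
    edge rewrite VecP.lookup-map v isActive t | VecP.lookup-map w isActive t
               | VecP.lookup-map v isInner t | VecP.lookup-map w isInner t =
      edge-split k (lookup t v) (lookup t w) σ (colourAt v) (colourAt w)

  split-contribution : ∀ {n} (E : SignedGraph n) k (t : Vec Part n) →
    sumOver (splitPalette t k) (λ x → bit (properOn (active t) E x))
      ≡ bit (admissible E t) * properCount E (innerSet t) k
  split-contribution E k t = begin
      sumOver (splitPalette t k) (λ x → bit (properOn (active t) E x))
    ≡⟨ sumOver-cong (splitPalette t k) (λ x x∈ →
         trans (cong bit (properOn-split k E t x∈)) (bit-∧ (admissible E t) _)) ⟩
      sumOver (splitPalette t k) (λ x → bit (admissible E t) * bit (properOn (innerSet t) E x))
    ≡⟨ sumOver-scale (splitPalette t k) (bit (admissible E t)) _ ⟩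
      bit (admissible E t) * sumOver (splitPalette t k) (λ x → bit (properOn (innerSet t) E x))
    ≡⟨ cong (bit (admissible E t) *_)
            (sumOver-inner k t _ _ λ x y agree → cong bit (properOn-agree (innerSet t) E agree)) ⟩
      bit (admissible E t) * properCount E (innerSet t) k ∎
    where open ≡-Reasoning

  -- The recursion in k: the unsplit split contributes properCount E s k itself.
  properCount-step : ∀ {n} (E : SignedGraph n) (s : Subset n) k →
    properCount E s (suc k)
      ≡ properCount E s k + sum (map (λ t → bit (admissible E t) * properCount E (innerSet t) k) (strictSplits s))
  properCount-step E s k = begin
      properCount E s (suc k)
    ≡⟨ sumOver-split s k _ ⟩
      sum (map (λ t → sumOver (splitPalette t k) (λ x → bit (properOn s E x))) (splits s))
    ≡⟨ sum-cong (splits s) (All.map (λ {t} active≡s → trans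
         (cong (λ a → sumOver (splitPalette t k) (λ x → bit (properOn a E x))) (sym active≡s))
         (split-contribution E k t)) (splits-active s)) ⟩
      bit (admissible E (unsplit s)) * properCount E (innerSet (unsplit s)) k + rest
    ≡⟨ cong₂ (λ a u → bit a * properCount E u k + rest) (admissible-unsplit E s) (unsplit-inner s) ⟩
      1 * properCount E s k + rest
    ≡⟨ cong (_+ rest) (*-identityˡ (properCount E s k)) ⟩
      properCount E s k + rest ∎
    where
    open ≡-Reasoning
    rest : ℕ
    rest = sum (map (λ t → bit (admissible E t) * properCount E (innerSet t) k) (strictSplits s))

  newtonCoefficient : ∀ {n} → SignedGraph n → Subset n → ℕ → ℕ
  newtonCoefficient E s zero    = properCount E s 0
  newtonCoefficient E s (suc j) =
    sum (map (λ t → bit (admissible E t) * newtonCoefficient E (innerSet t) j) (strictSplits s))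

  -- a_{s,j} = 0 for j > |s|, i.e. properCount E s has degree at most |s|.
  newtonCoefficient-vanishes : ∀ {n} (E : SignedGraph n) j (s : Subset n) → size s < j →
                               newtonCoefficient E s j ≡ 0
  newtonCoefficient-vanishes E zero    s ()
  newtonCoefficient-vanishes E (suc j) s |s|≤j = sum-zero (strictSplits s) (All.map
    (λ {t} smaller → trans (cong (bit (admissible E t) *_)
                                 (newtonCoefficient-vanishes E j (innerSet t) (<-≤-trans smaller (≤-pred |s|≤j))))
                           (*-zeroʳ (bit (admissible E t))))
    (strictSplits-inner-< s))

  newton : ℕ → (ℕ → ℕ) → ℕ → ℕ
  newton D c k = sum (applyUpTo (λ j → (k choose j) * c j) D)

  newton-at-0 : ∀ D (c : ℕ → ℕ) → c D ≡ 0 → newton D c 0 ≡ c 0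
  newton-at-0 zero    c c₀≡0 = sym c₀≡0
  newton-at-0 (suc D) c _    = begin
      1 * c 0 + sum (applyUpTo (λ _ → 0) D)
    ≡⟨ cong₂ _+_ (*-identityˡ (c 0))
                 (trans (sum-applyUpTo _ D) (sum-zero (List.upTo D) (All.tabulate λ _ → refl))) ⟩
      c 0 + 0
    ≡⟨ +-identityʳ (c 0) ⟩
      c 0 ∎
    where open ≡-Reasoning

  -- Pascal's rule: the forward difference of a Newton series (of length D,
  -- with c_D = 0) is the Newton series of the shifted coefficients.
  newton-suc : ∀ D (c : ℕ → ℕ) k → c D ≡ 0 → newton D c (suc k) ≡ newton D c k + newton D (c ∘ suc) k
  newton-suc zero    c k _        = refl
  newton-suc (suc D) c k c[1+D]≡0 = begin
      1 * c 0 + sum (applyUpTo (λ j → (suc k choose suc j) * c (suc j)) D)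
    ≡⟨ cong (λ z → 1 * c 0 + z) (trans (sum-applyUpTo-cong D pascal) (sum-applyUpTo-+ below above D)) ⟩
      1 * c 0 + (sum (applyUpTo below D) + sum (applyUpTo above D))
    ≡⟨ x∙yz≈y∙xz (1 * c 0) (sum (applyUpTo below D)) _ ⟩
      sum (applyUpTo below D) + (1 * c 0 + sum (applyUpTo above D))
    ≡⟨ +-comm (sum (applyUpTo below D)) _ ⟩
      newton (suc D) c k + sum (applyUpTo below D)
    ≡⟨ cong (λ z → newton (suc D) c k + z) (+-identityʳ _) ⟨
      newton (suc D) c k + (sum (applyUpTo below D) + 0)
    ≡⟨ cong (λ z → newton (suc D) c k + (sum (applyUpTo below D) + z))
            (trans (cong ((k choose D) *_) c[1+D]≡0) (*-zeroʳ (k choose D))) ⟨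
      newton (suc D) c k + (sum (applyUpTo below D) + (k choose D) * c (suc D))
    ≡⟨ cong (λ z → newton (suc D) c k + z) (sum-applyUpTo-last below D) ⟨
      newton (suc D) c k + newton (suc D) (c ∘ suc) k ∎
    where
    open ≡-Reasoning
    below above : ℕ → ℕ
    below j = (k choose j) * c (suc j)
    above j = (k choose suc j) * c (suc j)
    pascal : ∀ j → (suc k choose suc j) * c (suc j) ≡ below j + above j
    pascal j = trans (cong (_* c (suc j)) (sym (nCk+nC[k+1]≡[n+1]C[k+1] k j)))
                     (*-distribʳ-+ (c (suc j)) (k choose j) (k choose suc j))

  newton-linear : ∀ {T : Set} D k (a : T → ℕ) (c : T → ℕ → ℕ) (ts : List T) →
    sum (map (λ t → a t * newton D (c t) k) ts) ≡ newton D (λ j → sum (map (λ t → a t * c t j) ts)) k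
  newton-linear D k a c ts = begin
      sum (map (λ t → a t * newton D (c t) k) ts)
    ≡⟨ sum-cong ts (All.tabulate λ {t} _ →
         trans (cong (a t *_) (sum-applyUpTo _ D)) (*-distrib-sum (a t) _ js)) ⟩
      sum (map (λ t → sum (map (λ j → a t * ((k choose j) * c t j)) js)) ts)
    ≡⟨ sum-swap (λ t j → a t * ((k choose j) * c t j)) ts js ⟩
      sum (map (λ j → sum (map (λ t → a t * ((k choose j) * c t j)) ts)) js)
    ≡⟨ sum-cong js (All.tabulate λ {j} _ →
         trans (sum-cong ts (All.tabulate λ {t} _ → x*yz≡y*xz (a t) (k choose j) (c t j)))
               (sym (*-distrib-sum (k choose j) _ ts))) ⟩
      sum (map (λ j → (k choose j) * sum (map (λ t → a t * c t j) ts)) js)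
    ≡⟨ sum-applyUpTo _ D ⟨
      newton D (λ j → sum (map (λ t → a t * c t j) ts)) k ∎
    where
    open ≡-Reasoning
    js : List ℕ
    js = List.upTo D

  properCount-newton : ∀ {n} (E : SignedGraph n) D → (∀ s → newtonCoefficient E s D ≡ 0) →
                       ∀ k s → properCount E s k ≡ newton D (newtonCoefficient E s) k
  properCount-newton E D vanish zero    s = sym (newton-at-0 D (newtonCoefficient E s) (vanish s))
  properCount-newton {n} E D vanish (suc k) s = begin
      properCount E s (suc k)
    ≡⟨ properCount-step E s k ⟩
      properCount E s k + sum (map (λ t → bit (admissible E t) * properCount E (innerSet t) k) (strictSplits s))
    ≡⟨ cong₂ _+_ (properCount-newton E D vanish k s)
                 (sum-cong (strictSplits s) (All.tabulate λ {t} _ →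
                    cong (bit (admissible E t) *_) (properCount-newton E D vanish k (innerSet t)))) ⟩
      newton D (a s) k + sum (map (λ t → bit (admissible E t) * newton D (a (innerSet t)) k) (strictSplits s))
    ≡⟨ cong (λ z → newton D (a s) k + z)
            (newton-linear D k (bit ∘ admissible E) (a ∘ innerSet) (strictSplits s)) ⟩
      newton D (a s) k + newton D (a s ∘ suc) k
    ≡⟨ newton-suc D (a s) k (vanish s) ⟨
      newton D (a s) (suc k) ∎
    where
    open ≡-Reasoning
    a : Subset n → ℕ → ℕ
    a = newtonCoefficient E

  chromatic-newton : ∀ {n} (E : SignedGraph n) D → n < D →
                     ∀ k → chromatic E k ≡ newton D (newtonCoefficient E ⊤) k
  chromatic-newton E D n<D k =
    trans (chromatic≡properCount E k)
          (properCount-newton E D (λ s → newtonCoefficient-vanishes E D s (≤-<-trans (∣p∣≤n s) n<D)) k ⊤)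

open Counting using (newton; newtonCoefficient; chromatic-newton)

open import Data.Fin.Subset using (⊤)
open import Data.Integer using (ℤ; +_; -_; _+_; _-_; _*_; _^_)
import Data.Integer.Properties as ℤP
open import Data.Integer.Tactic.RingSolver using (solve-∀)
open import Data.List using (List; applyUpTo; foldr)
open import Data.Nat as ℕ using (ℕ; zero; suc; _!; _<_; _≤_; _<?_)
open import Data.Nat.Combinatorics using (nCk+nC[k+1]≡[n+1]C[k+1]) renaming (_C_ to _choose_)
open import Data.Nat.ListAction using (sum)
open import Data.Product using (_×_; _,_)
open import Data.Vec as Vec using (Vec; []; _∷_)
open import Function using (_∘_)
open import Relation.Binary.PropositionalEquality using (_≡_; refl; sym; trans; cong; cong₂; module ≡-Reasoning)
open import Relation.Nullary.Decidable using (from-yes)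

falling : ℤ → ℕ → ℤ
falling K zero    = + 1
falling K (suc j) = falling K j * (K - + j)

falling-at-0 : ∀ j → falling (+ 0) (suc j) ≡ + 0
falling-at-0 zero    = refl
falling-at-0 (suc j) = cong (_* (+ 0 - + suc j)) (falling-at-0 j)

falling-shift : ∀ K j → falling (+ 1 + K) (suc j) ≡ (+ 1 + K) * falling K j
falling-shift K zero    = one-factor K
  where
  one-factor : ∀ K → + 1 * (+ 1 + K - + 0) ≡ (+ 1 + K) * + 1
  one-factor = solve-∀
falling-shift K (suc j) = begin
    falling (+ 1 + K) (suc j) * (+ 1 + K - (+ 1 + + j))
  ≡⟨ cong (_* (+ 1 + K - (+ 1 + + j))) (falling-shift K j) ⟩
    (+ 1 + K) * falling K j * (+ 1 + K - (+ 1 + + j))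
  ≡⟨ reassociate K (falling K j) (+ j) ⟩
    (+ 1 + K) * (falling K j * (K - + j)) ∎
  where
  open ≡-Reasoning
  reassociate : ∀ K F J → (+ 1 + K) * F * (+ 1 + K - (+ 1 + J)) ≡ (+ 1 + K) * (F * (K - J))
  reassociate = solve-∀

factorial-choose : ∀ k j → + (j !) * + (k choose j) ≡ falling (+ k) j
factorial-choose k       zero    = refl
factorial-choose zero    (suc j) = trans (ℤP.*-zeroʳ (+ (suc j !))) (sym (falling-at-0 j))
factorial-choose (suc k) (suc j) = begin
    + (suc j !) * + (suc k choose suc j)
  ≡⟨ cong (λ m → + (suc j !) * + m) (sym (nCk+nC[k+1]≡[n+1]C[k+1] k j)) ⟩
    + (suc j !) * + ((k choose j) ℕ.+ (k choose suc j))
  ≡⟨ cong₂ _*_ (ℤP.pos-* (suc j) (j !)) (ℤP.pos-+ (k choose j) (k choose suc j)) ⟩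
    + suc j * + (j !) * (+ (k choose j) + + (k choose suc j))
  ≡⟨ distribute (+ suc j) (+ (j !)) (+ (k choose j)) (+ (k choose suc j)) ⟩
    + suc j * (+ (j !) * + (k choose j)) + + suc j * + (j !) * + (k choose suc j)
  ≡⟨ cong₂ (λ a b → + suc j * a + b) (factorial-choose k j)
           (trans (cong (_* + (k choose suc j)) (sym (ℤP.pos-* (suc j) (j !)))) (factorial-choose k (suc j))) ⟩
    (+ 1 + + j) * falling (+ k) j + falling (+ k) j * (+ k - + j)
  ≡⟨ collect (+ j) (+ k) (falling (+ k) j) ⟩
    (+ 1 + + k) * falling (+ k) j
  ≡⟨ falling-shift (+ k) j ⟨
    falling (+ suc k) (suc j) ∎
  where
  open ≡-Reasoning
  distribute : ∀ J F A B → J * F * (A + B) ≡ J * (F * A) + J * F * B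
  distribute = solve-∀
  collect : ∀ J K F → (+ 1 + J) * F + F * (K - J) ≡ (+ 1 + K) * F
  collect = solve-∀

poly : Vec ℤ 6 → ℤ → ℤ
poly (p₀ ∷ p₁ ∷ p₂ ∷ p₃ ∷ p₄ ∷ p₅ ∷ []) K = p₀ + K * (p₁ + K * (p₂ + K * (p₃ + K * (p₄ + K * p₅))))

poly-scale : ∀ a p K → poly (Vec.map (a *_) p) K ≡ a * poly p K
poly-scale a (p₀ ∷ p₁ ∷ p₂ ∷ p₃ ∷ p₄ ∷ p₅ ∷ []) = distribute a p₀ p₁ p₂ p₃ p₄ p₅
  where
  distribute : ∀ a p₀ p₁ p₂ p₃ p₄ p₅ K →
    a * p₀ + K * (a * p₁ + K * (a * p₂ + K * (a * p₃ + K * (a * p₄ + K * (a * p₅)))))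
    ≡ a * (p₀ + K * (p₁ + K * (p₂ + K * (p₃ + K * (p₄ + K * p₅)))))
  distribute = solve-∀

firstSix : (ℕ → ℕ) → Vec ℕ 6
firstSix c = c 0 ∷ c 1 ∷ c 2 ∷ c 3 ∷ c 4 ∷ c 5 ∷ []

-- The coefficients of 5! · Σ_{j<6} (k choose j) a_j as a polynomial in k.
monomials : Vec ℕ 6 → Vec ℤ 6
monomials (a₀ ∷ a₁ ∷ a₂ ∷ a₃ ∷ a₄ ∷ a₅ ∷ []) =
  + 120 * + a₀ ∷
  + 120 * + a₁ - + 60 * + a₂ + + 40 * + a₃ - + 30 * + a₄ + + 24 * + a₅ ∷
  + 60 * + a₂ - + 60 * + a₃ + + 55 * + a₄ - + 50 * + a₅ ∷
  + 20 * + a₃ - + 30 * + a₄ + + 35 * + a₅ ∷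
  + 5 * + a₄ - + 10 * + a₅ ∷
  + a₅ ∷ []

sumℤ : List ℤ → ℤ
sumℤ = foldr _+_ (+ 0)

pos-sum-* : ∀ (f g : ℕ → ℕ) D →
            + sum (applyUpTo (λ j → f j ℕ.* g j) D) ≡ sumℤ (applyUpTo (λ j → + f j * + g j) D)
pos-sum-* f g zero    = refl
pos-sum-* f g (suc D) =
  trans (ℤP.pos-+ (f 0 ℕ.* g 0) _) (cong₂ _+_ (ℤP.pos-* (f 0) (g 0)) (pos-sum-* (f ∘ suc) (g ∘ suc) D))

newton-monomials : ∀ (c : ℕ → ℕ) k → + 120 * + newton 6 c k ≡ poly (monomials (firstSix c)) (+ k)
newton-monomials c k = begin
    + 120 * + newton 6 c k
  ≡⟨ cong (+ 120 *_) (pos-sum-* (k choose_) c 6) ⟩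
    + 120 * sumℤ (applyUpTo (λ j → + (k choose j) * + c j) 6)
  ≡⟨ weigh (+ (k choose 0)) (+ (k choose 1)) (+ (k choose 2)) (+ (k choose 3)) (+ (k choose 4)) (+ (k choose 5))
           (+ c 0) (+ c 1) (+ c 2) (+ c 3) (+ c 4) (+ c 5) ⟩
    + 120 * + c 0 * (+ 1 * + (k choose 0)) + + 120 * + c 1 * (+ 1 * + (k choose 1))
      + + 60 * + c 2 * (+ 2 * + (k choose 2)) + + 20 * + c 3 * (+ 6 * + (k choose 3))
      + + 5 * + c 4 * (+ 24 * + (k choose 4)) + + 1 * + c 5 * (+ 120 * + (k choose 5))
  ≡⟨ cong₂ _+_ (cong₂ _+_ (cong₂ _+_ (cong₂ _+_ (cong₂ _+_ (term (+ 120) 0) (term (+ 120) 1))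
                                              (term (+ 60) 2)) (term (+ 20) 3)) (term (+ 5) 4)) (term (+ 1) 5) ⟩
    + 120 * + c 0 * falling (+ k) 0 + + 120 * + c 1 * falling (+ k) 1
      + + 60 * + c 2 * falling (+ k) 2 + + 20 * + c 3 * falling (+ k) 3
      + + 5 * + c 4 * falling (+ k) 4 + + 1 * + c 5 * falling (+ k) 5
  ≡⟨ expand (+ c 0) (+ c 1) (+ c 2) (+ c 3) (+ c 4) (+ c 5) (+ k) ⟩
    poly (monomials (firstSix c)) (+ k) ∎
  where
  open ≡-Reasoning
  term : ∀ w j → w * + c j * (+ (j !) * + (k choose j)) ≡ w * + c j * falling (+ k) j
  term w j = cong (w * + c j *_) (factorial-choose k j)
  weigh : ∀ C₀ C₁ C₂ C₃ C₄ C₅ c₀ c₁ c₂ c₃ c₄ c₅ →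
    + 120 * (C₀ * c₀ + (C₁ * c₁ + (C₂ * c₂ + (C₃ * c₃ + (C₄ * c₄ + (C₅ * c₅ + + 0))))))
    ≡ + 120 * c₀ * (+ 1 * C₀) + + 120 * c₁ * (+ 1 * C₁) + + 60 * c₂ * (+ 2 * C₂)
      + + 20 * c₃ * (+ 6 * C₃) + + 5 * c₄ * (+ 24 * C₄) + + 1 * c₅ * (+ 120 * C₅)
  weigh = solve-∀
  -- (falling K j written out as the product it unfolds to)
  expand : ∀ c₀ c₁ c₂ c₃ c₄ c₅ K →
    + 120 * c₀ * + 1 + + 120 * c₁ * (+ 1 * (K - + 0)) + + 60 * c₂ * (+ 1 * (K - + 0) * (K - + 1))
      + + 20 * c₃ * (+ 1 * (K - + 0) * (K - + 1) * (K - + 2))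
      + + 5 * c₄ * (+ 1 * (K - + 0) * (K - + 1) * (K - + 2) * (K - + 3))
      + + 1 * c₅ * (+ 1 * (K - + 0) * (K - + 1) * (K - + 2) * (K - + 3) * (K - + 4))
    ≡ + 120 * c₀ + K * ((+ 120 * c₁ - + 60 * c₂ + + 40 * c₃ - + 30 * c₄ + + 24 * c₅)
      + K * ((+ 60 * c₂ - + 60 * c₃ + + 55 * c₄ - + 50 * c₅) + K * ((+ 20 * c₃ - + 30 * c₄ + + 35 * c₅)
      + K * ((+ 5 * c₄ - + 10 * c₅) + K * c₅))))
  expand = solve-∀

chromatic-polynomial : ∀ {n} (E : SignedGraph n) → n < 6 →
  (a : Vec ℕ 6) → firstSix (newtonCoefficient E ⊤) ≡ a →
  (p : Vec ℤ 6) → monomials a ≡ Vec.map (+ 120 *_) p →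
  ∀ k → + chromatic E k ≡ poly p (+ k)
chromatic-polynomial E n<6 a newton-a p monomials-p k =
  ℤP.*-cancelˡ-≡ (+ 120) (+ chromatic E k) (poly p (+ k)) (begin
    + 120 * + chromatic E k
  ≡⟨ cong (λ m → + 120 * + m) (chromatic-newton E 6 n<6 k) ⟩
    + 120 * + newton 6 (newtonCoefficient E ⊤) k
  ≡⟨ newton-monomials (newtonCoefficient E ⊤) k ⟩
    poly (monomials (firstSix (newtonCoefficient E ⊤))) (+ k)
  ≡⟨ cong (λ v → poly (monomials v) (+ k)) newton-a ⟩
    poly (monomials a) (+ k)
  ≡⟨ cong (λ q → poly q (+ k)) monomials-p ⟩
    poly (Vec.map (+ 120 *_) p) (+ k)
  ≡⟨ poly-scale (+ 120) p (+ k) ⟩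
    + 120 * poly p (+ k) ∎)
  where open ≡-Reasoning

-- Each lemma gives the Newton coefficients of the graph
-- (evaluated by Agda) and the coefficients of its polynomial, then matches the
-- Horner form with the stated polynomial (K ^ n written as the product it
-- unfolds to, which the ring solver can normalise).

K3-1-polynomial : ∀ k → + chromatic K3-1 k ≡ (+ 8) * (+ k) ^ 3 - (+ 2) * (+ k)
K3-1-polynomial k =
  trans (chromatic-polynomial K3-1 (from-yes (3 <? 6)) (0 ∷ 6 ∷ 48 ∷ 48 ∷ 0 ∷ 0 ∷ []) refl
                              (+ 0 ∷ - + 2 ∷ + 0 ∷ + 8 ∷ + 0 ∷ + 0 ∷ []) refl k)
        (expand (+ k))
  where
  expand : ∀ K → + 0 + K * (- + 2 + K * (+ 0 + K * (+ 8 + K * (+ 0 + K * + 0)))) ≡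
                 (+ 8) * (K * (K * (K * + 1)))
                 - (+ 2) * K
  expand = solve-∀

K3-2-polynomial : ∀ k → + chromatic K3-2 k ≡ (+ 8) * (+ k) ^ 3
K3-2-polynomial k =
  trans (chromatic-polynomial K3-2 (from-yes (3 <? 6)) (0 ∷ 8 ∷ 48 ∷ 48 ∷ 0 ∷ 0 ∷ []) refl
                              (+ 0 ∷ + 0 ∷ + 0 ∷ + 8 ∷ + 0 ∷ + 0 ∷ []) refl k)
        (expand (+ k))
  where
  expand : ∀ K → + 0 + K * (+ 0 + K * (+ 0 + K * (+ 8 + K * (+ 0 + K * + 0)))) ≡
                 (+ 8) * (K * (K * (K * + 1)))
  expand = solve-∀

K4-1-polynomial : ∀ k → + chromatic K4-1 k ≡ (+ 16) * (+ k) ^ 4 - (+ 16) * (+ k) ^ 3 - (+ 4) * (+ k) ^ 2 + (+ 4) * (+ k)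
K4-1-polynomial k =
  trans (chromatic-polynomial K4-1 (from-yes (4 <? 6)) (0 ∷ 0 ∷ 120 ∷ 480 ∷ 384 ∷ 0 ∷ []) refl
                              (+ 0 ∷ + 4 ∷ - + 4 ∷ - + 16 ∷ + 16 ∷ + 0 ∷ []) refl k)
        (expand (+ k))
  where
  expand : ∀ K → + 0 + K * (+ 4 + K * (- + 4 + K * (- + 16 + K * (+ 16 + K * + 0)))) ≡
                 (+ 16) * (K * (K * (K * (K * + 1))))
                 - (+ 16) * (K * (K * (K * + 1)))
                 - (+ 4) * (K * (K * + 1))
                 + (+ 4) * K
  expand = solve-∀

K4-2-polynomial : ∀ k → + chromatic K4-2 k ≡ (+ 16) * (+ k) ^ 4 - (+ 16) * (+ k) ^ 3 + (+ 4) * (+ k) ^ 2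
K4-2-polynomial k =
  trans (chromatic-polynomial K4-2 (from-yes (4 <? 6)) (0 ∷ 4 ∷ 136 ∷ 480 ∷ 384 ∷ 0 ∷ []) refl
                              (+ 0 ∷ + 0 ∷ + 4 ∷ - + 16 ∷ + 16 ∷ + 0 ∷ []) refl k)
        (expand (+ k))
  where
  expand : ∀ K → + 0 + K * (+ 0 + K * (+ 4 + K * (- + 16 + K * (+ 16 + K * + 0)))) ≡
                 (+ 16) * (K * (K * (K * (K * + 1))))
                 - (+ 16) * (K * (K * (K * + 1)))
                 + (+ 4) * (K * (K * + 1))
  expand = solve-∀

K4-3-polynomial : ∀ k → + chromatic K4-3 k ≡ (+ 16) * (+ k) ^ 4 - (+ 16) * (+ k) ^ 3 + (+ 12) * (+ k) ^ 2 - (+ 2) * (+ k)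
K4-3-polynomial k =
  trans (chromatic-polynomial K4-3 (from-yes (4 <? 6)) (0 ∷ 10 ∷ 152 ∷ 480 ∷ 384 ∷ 0 ∷ []) refl
                              (+ 0 ∷ - + 2 ∷ + 12 ∷ - + 16 ∷ + 16 ∷ + 0 ∷ []) refl k)
        (expand (+ k))
  where
  expand : ∀ K → + 0 + K * (- + 2 + K * (+ 12 + K * (- + 16 + K * (+ 16 + K * + 0)))) ≡
                 (+ 16) * (K * (K * (K * (K * + 1))))
                 - (+ 16) * (K * (K * (K * + 1)))
                 + (+ 12) * (K * (K * + 1))
                 - (+ 2) * K
  expand = solve-∀

K5-1-polynomial : ∀ k → + chromatic K5-1 k ≡ (+ 32) * (+ k) ^ 5 - (+ 80) * (+ k) ^ 4 + (+ 40) * (+ k) ^ 3 + (+ 20) * (+ k) ^ 2 - (+ 12) * (+ k)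
K5-1-polynomial k =
  trans (chromatic-polynomial K5-1 (from-yes (5 <? 6)) (0 ∷ 0 ∷ 120 ∷ 2160 ∷ 5760 ∷ 3840 ∷ []) refl
                              (+ 0 ∷ - + 12 ∷ + 20 ∷ + 40 ∷ - + 80 ∷ + 32 ∷ []) refl k)
        (expand (+ k))
  where
  expand : ∀ K → + 0 + K * (- + 12 + K * (+ 20 + K * (+ 40 + K * (- + 80 + K * + 32)))) ≡
                 (+ 32) * (K * (K * (K * (K * (K * + 1)))))
                 - (+ 80) * (K * (K * (K * (K * + 1))))
                 + (+ 40) * (K * (K * (K * + 1)))
                 + (+ 20) * (K * (K * + 1))
                 - (+ 12) * K
  expand = solve-∀

K5-2-polynomial : ∀ k → + chromatic K5-2 k ≡ (+ 32) * (+ k) ^ 5 - (+ 80) * (+ k) ^ 4 + (+ 64) * (+ k) ^ 3 - (+ 16) * (+ k) ^ 2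
K5-2-polynomial k =
  trans (chromatic-polynomial K5-2 (from-yes (5 <? 6)) (0 ∷ 0 ∷ 192 ∷ 2304 ∷ 5760 ∷ 3840 ∷ []) refl
                              (+ 0 ∷ + 0 ∷ - + 16 ∷ + 64 ∷ - + 80 ∷ + 32 ∷ []) refl k)
        (expand (+ k))
  where
  expand : ∀ K → + 0 + K * (+ 0 + K * (- + 16 + K * (+ 64 + K * (- + 80 + K * + 32)))) ≡
                 (+ 32) * (K * (K * (K * (K * (K * + 1)))))
                 - (+ 80) * (K * (K * (K * (K * + 1))))
                 + (+ 64) * (K * (K * (K * + 1)))
                 - (+ 16) * (K * (K * + 1))
  expand = solve-∀

K5-3-polynomial : ∀ k → + chromatic K5-3 k ≡ (+ 32) * (+ k) ^ 5 - (+ 80) * (+ k) ^ 4 + (+ 88) * (+ k) ^ 3 - (+ 48) * (+ k) ^ 2 + (+ 10) * (+ k)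
K5-3-polynomial k =
  trans (chromatic-polynomial K5-3 (from-yes (5 <? 6)) (0 ∷ 2 ∷ 272 ∷ 2448 ∷ 5760 ∷ 3840 ∷ []) refl
                              (+ 0 ∷ + 10 ∷ - + 48 ∷ + 88 ∷ - + 80 ∷ + 32 ∷ []) refl k)
        (expand (+ k))
  where
  expand : ∀ K → + 0 + K * (+ 10 + K * (- + 48 + K * (+ 88 + K * (- + 80 + K * + 32)))) ≡
                 (+ 32) * (K * (K * (K * (K * (K * + 1)))))
                 - (+ 80) * (K * (K * (K * (K * + 1))))
                 + (+ 88) * (K * (K * (K * + 1)))
                 - (+ 48) * (K * (K * + 1))
                 + (+ 10) * K
  expand = solve-∀

K5-4-polynomial : ∀ k → + chromatic K5-4 k ≡ (+ 32) * (+ k) ^ 5 - (+ 80) * (+ k) ^ 4 + (+ 72) * (+ k) ^ 3 - (+ 28) * (+ k) ^ 2 + (+ 4) * (+ k)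
K5-4-polynomial k =
  trans (chromatic-polynomial K5-4 (from-yes (5 <? 6)) (0 ∷ 0 ∷ 216 ∷ 2352 ∷ 5760 ∷ 3840 ∷ []) refl
                              (+ 0 ∷ + 4 ∷ - + 28 ∷ + 72 ∷ - + 80 ∷ + 32 ∷ []) refl k)
        (expand (+ k))
  where
  expand : ∀ K → + 0 + K * (+ 4 + K * (- + 28 + K * (+ 72 + K * (- + 80 + K * + 32)))) ≡
                 (+ 32) * (K * (K * (K * (K * (K * + 1)))))
                 - (+ 80) * (K * (K * (K * (K * + 1))))
                 + (+ 72) * (K * (K * (K * + 1)))
                 - (+ 28) * (K * (K * + 1))
                 + (+ 4) * K
  expand = solve-∀

K5-5-polynomial : ∀ k → + chromatic K5-5 k ≡ (+ 32) * (+ k) ^ 5 - (+ 80) * (+ k) ^ 4 + (+ 96) * (+ k) ^ 3 - (+ 56) * (+ k) ^ 2 + (+ 12) * (+ k)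
K5-5-polynomial k =
  trans (chromatic-polynomial K5-5 (from-yes (5 <? 6)) (0 ∷ 4 ∷ 304 ∷ 2496 ∷ 5760 ∷ 3840 ∷ []) refl
                              (+ 0 ∷ + 12 ∷ - + 56 ∷ + 96 ∷ - + 80 ∷ + 32 ∷ []) refl k)
        (expand (+ k))
  where
  expand : ∀ K → + 0 + K * (+ 12 + K * (- + 56 + K * (+ 96 + K * (- + 80 + K * + 32)))) ≡
                 (+ 32) * (K * (K * (K * (K * (K * + 1)))))
                 - (+ 80) * (K * (K * (K * (K * + 1))))
                 + (+ 96) * (K * (K * (K * + 1)))
                 - (+ 56) * (K * (K * + 1))
                 + (+ 12) * K
  expand = solve-∀

K5-6-polynomial : ∀ k → + chromatic K5-6 k ≡ (+ 32) * (+ k) ^ 5 - (+ 80) * (+ k) ^ 4 + (+ 80) * (+ k) ^ 3 - (+ 40) * (+ k) ^ 2 + (+ 8) * (+ k)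
K5-6-polynomial k =
  trans (chromatic-polynomial K5-6 (from-yes (5 <? 6)) (0 ∷ 0 ∷ 240 ∷ 2400 ∷ 5760 ∷ 3840 ∷ []) refl
                              (+ 0 ∷ + 8 ∷ - + 40 ∷ + 80 ∷ - + 80 ∷ + 32 ∷ []) refl k)
        (expand (+ k))
  where
  expand : ∀ K → + 0 + K * (+ 8 + K * (- + 40 + K * (+ 80 + K * (- + 80 + K * + 32)))) ≡
                 (+ 32) * (K * (K * (K * (K * (K * + 1)))))
                 - (+ 80) * (K * (K * (K * (K * + 1))))
                 + (+ 80) * (K * (K * (K * + 1)))
                 - (+ 40) * (K * (K * + 1))
                 + (+ 8) * K
  expand = solve-∀

K5-7-polynomial : ∀ k → + chromatic K5-7 k ≡ (+ 32) * (+ k) ^ 5 - (+ 80) * (+ k) ^ 4 + (+ 120) * (+ k) ^ 3 - (+ 80) * (+ k) ^ 2 + (+ 20) * (+ k)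
K5-7-polynomial k =
  trans (chromatic-polynomial K5-7 (from-yes (5 <? 6)) (0 ∷ 12 ∷ 400 ∷ 2640 ∷ 5760 ∷ 3840 ∷ []) refl
                              (+ 0 ∷ + 20 ∷ - + 80 ∷ + 120 ∷ - + 80 ∷ + 32 ∷ []) refl k)
        (expand (+ k))
  where
  expand : ∀ K → + 0 + K * (+ 20 + K * (- + 80 + K * (+ 120 + K * (- + 80 + K * + 32)))) ≡
                 (+ 32) * (K * (K * (K * (K * (K * + 1)))))
                 - (+ 80) * (K * (K * (K * (K * + 1))))
                 + (+ 120) * (K * (K * (K * + 1)))
                 - (+ 80) * (K * (K * + 1))
                 + (+ 20) * K
  expand = solve-∀

-- The main theorem.
theorem2 : (k : ℕ) → 1 ≤ k →
    (+ (chromatic K3-1 k) ≡ (+ 8) * (+ k) ^ 3 - (+ 2) * (+ k))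
  × (+ (chromatic K3-2 k) ≡ (+ 8) * (+ k) ^ 3)
  × (+ (chromatic K4-1 k) ≡ (+ 16) * (+ k) ^ 4 - (+ 16) * (+ k) ^ 3 - (+ 4) * (+ k) ^ 2 + (+ 4) * (+ k))
  × (+ (chromatic K4-2 k) ≡ (+ 16) * (+ k) ^ 4 - (+ 16) * (+ k) ^ 3 + (+ 4) * (+ k) ^ 2)
  × (+ (chromatic K4-3 k) ≡ (+ 16) * (+ k) ^ 4 - (+ 16) * (+ k) ^ 3 + (+ 12) * (+ k) ^ 2 - (+ 2) * (+ k))
  × (+ (chromatic K5-1 k) ≡ (+ 32) * (+ k) ^ 5 - (+ 80) * (+ k) ^ 4 + (+ 40) * (+ k) ^ 3 + (+ 20) * (+ k) ^ 2 - (+ 12) * (+ k))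
  × (+ (chromatic K5-2 k) ≡ (+ 32) * (+ k) ^ 5 - (+ 80) * (+ k) ^ 4 + (+ 64) * (+ k) ^ 3 - (+ 16) * (+ k) ^ 2)
  × (+ (chromatic K5-3 k) ≡ (+ 32) * (+ k) ^ 5 - (+ 80) * (+ k) ^ 4 + (+ 88) * (+ k) ^ 3 - (+ 48) * (+ k) ^ 2 + (+ 10) * (+ k))
  × (+ (chromatic K5-4 k) ≡ (+ 32) * (+ k) ^ 5 - (+ 80) * (+ k) ^ 4 + (+ 72) * (+ k) ^ 3 - (+ 28) * (+ k) ^ 2 + (+ 4) * (+ k))
  × (+ (chromatic K5-5 k) ≡ (+ 32) * (+ k) ^ 5 - (+ 80) * (+ k) ^ 4 + (+ 96) * (+ k) ^ 3 - (+ 56) * (+ k) ^ 2 + (+ 12) * (+ k))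
  × (+ (chromatic K5-6 k) ≡ (+ 32) * (+ k) ^ 5 - (+ 80) * (+ k) ^ 4 + (+ 80) * (+ k) ^ 3 - (+ 40) * (+ k) ^ 2 + (+ 8) * (+ k))
  × (+ (chromatic K5-7 k) ≡ (+ 32) * (+ k) ^ 5 - (+ 80) * (+ k) ^ 4 + (+ 120) * (+ k) ^ 3 - (+ 80) * (+ k) ^ 2 + (+ 20) * (+ k))
theorem2 k _ =
    K3-1-polynomial k
  , K3-2-polynomial k
  , K4-1-polynomial k
  , K4-2-polynomial k
  , K4-3-polynomial k
  , K5-1-polynomial k
  , K5-2-polynomial k
  , K5-3-polynomial k
  , K5-4-polynomial k
  , K5-5-polynomial k
  , K5-6-polynomial k
  , K5-7-polynomial k
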